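{- For every $n\ge1$, $\mathrm{Sort}_n(\mathfrak{s}_{\underline{23}1})=\mathrm{Av}_n(1324,\mu_{2413})$, where $\mu_{2413}$ is the mesh pattern $(2413,\{(1,0),(2,1),(2,2)\})$.
   Context: A pattern is a permutation $\sigma$ in which some blocks of consecutive entries may be underlined; a sequence contains it if it has a subsequence order-isomorphic to $\sigma$ whose entries corresponding to a common underlined block are adjacent in the sequence. Mesh pattern $(\rho,A)$ with $\rho\in\mathfrak S_k$, $A\subseteq\{0,\dots,k\}^2$: a permutation $\pi\in\mathfrak S_n$ contains it if there are positions $i_1<\dots<i_k$ with $\pi_{i_1}\cdots\pi_{i_k}$ order-isomorphic to $\rho$ such that for each $(a,b)\in A$ no entry $\pi_j$ has $i_a<j<i_{a+1}$ and $v_b<\pi_j<v_{b+1}$, where $i_0=0$, $i_{k+1}=n+1$, $v_1<\dots<v_k$ are the values $\pi_{i_1},\dots,\pi_{i_k}$ sorted, $v_0=0$, $v_{k+1}=n+1$. $\mathrm{Av}_n(\dots)$ is the set of $\tau\in\mathfrak S_n$ avoiding all listed (classical or mesh) patterns. Pattern-avoiding stack map $\mathfrak{s}_\sigma$: process input $\tau_1,\dots,\tau_n$ in order; when $\tau_i$ is next, while the stack is nonempty and the sequence formed by placing $\tau_i$ on top of the stack, read top to bottom, contains $\sigma$ (underlined entries adjacent in the stack), pop the top entry to the output; then push $\tau_i$; at the end pop all remaining entries top to bottom to the output. West's stack-sorting map $s$ pushes each input entry after popping all smaller stack entries to the output, emptying the stack at the end. $\mathrm{Sort}_n(\mathfrak{s}_\sigma)=\{\tau\in\mathfrak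 S_n: s(\mathfrak{s}_\sigma(\tau))=12\cdots n\}$ (equivalently $\mathfrak{s}_\sigma(\tau)$ avoids $231$). -}

module Defs where

open import Data.Nat using (ℕ; zero; suc; _+_; _<_; _<ᵇ_)
open import Data.Bool using (Bool; true; false; _∧_; _∨_; if_then_else_)
open import Data.List using (List; []; _∷_; _++_; [_]; length; lookup; map; upTo)
open import Data.Bool.ListAction using (any)
open import Data.Fin using (Fin; toℕ)
open import Data.Product using (Σ; _×_; _,_; ∃)
open import Data.Sum using (_⊎_)
open import Data.List.Membership.Propositional using (_∈_)
open import Relation.Binary.PropositionalEquality using (_≡_)
open import Relation.Nullary using (¬_)
open import Function.Bundles using (_⇔_)

-- Permutations of [n] are lists of naturals that are rearrangements of
-- 1 2 ... n (one-line notation).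

idPerm : ℕ → List ℕ
idPerm n = map suc (upTo n)

contains-u23-1 : List ℕ → Bool
contains-u23-1 (x ∷ y ∷ rest) =
  ((x <ᵇ y) ∧ any (λ z → z <ᵇ x) rest) ∨ contains-u23-1 (y ∷ rest)
contains-u23-1 _ = false

-- The stack is a list whose head is the top of the stack.
-- popWhile t st out : while the stack is nonempty and (t on top of the
-- stack, read top to bottom) contains the pattern, pop the top to output.

popWhile : ℕ → List ℕ → List ℕ → List ℕ × List ℕ
popWhile t [] out = [] , out
popWhile t (s ∷ st) out =
  if contains-u23-1 (t ∷ s ∷ st)
  then popWhile t st (out ++ [ s ])
  else (s ∷ st , out)

stackRun : List ℕ → List ℕ → List ℕ → List ℕ
stackRun [] st out = out ++ st
stackRun (t ∷ ts) st out with popWhile t st out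
... | st' , out' = stackRun ts (t ∷ st') out'

stackMap-u23-1 : List ℕ → List ℕ
stackMap-u23-1 τ = stackRun τ [] []

westPop : ℕ → List ℕ → List ℕ → List ℕ × List ℕ
westPop t [] out = [] , out
westPop t (s ∷ st) out =
  if s <ᵇ t then westPop t st (out ++ [ s ]) else (s ∷ st , out)

westRun : List ℕ → List ℕ → List ℕ → List ℕ
westRun [] st out = out ++ st
westRun (t ∷ ts) st out with westPop t st out
... | st' , out' = westRun ts (t ∷ st') out'

westSort : List ℕ → List ℕ
westSort τ = westRun τ [] []

SortedBy-u23-1 : ℕ → List ℕ → Set
SortedBy-u23-1 n τ = westSort (stackMap-u23-1 τ) ≡ idPerm n

record Occurrence (π ρ : List ℕ) : Set where
  field
    idx  : Fin (length ρ) → Fin (length π)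
    mono : ∀ a b → toℕ a < toℕ b → toℕ (idx a) < toℕ (idx b)
    iso  : ∀ a b → (lookup ρ a < lookup ρ b) ⇔ (lookup π (idx a) < lookup π (idx b))

open Occurrence public

Contains : List ℕ → List ℕ → Set
Contains π ρ = Occurrence π ρ

-- Mesh conditions (1-based positions i_1..i_k, i_0 = 0, i_{k+1} = n+1;
-- values v_1<..<v_k, v_0 = 0, v_{k+1} = n+1; v_b is the value of the
-- occurrence entry corresponding to the entry of ρ equal to b).
module _ {π ρ : List ℕ} (o : Occurrence π ρ) where

  -- i_a < p  (p a 1-based position)
  PosAbove : ℕ → ℕ → Set
  PosAbove a p = a ≡ 0 ⊎ Σ (Fin (length ρ)) λ c → (suc (toℕ c) ≡ a) × (suc (toℕ (idx o c)) < p)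

  -- p < i_a
  PosBelow : ℕ → ℕ → Set
  PosBelow a p = a ≡ suc (length ρ) ⊎ Σ (Fin (length ρ)) λ c → (suc (toℕ c) ≡ a) × (p < suc (toℕ (idx o c)))

  -- v_b < x
  ValAbove : ℕ → ℕ → Set
  ValAbove b x = b ≡ 0 ⊎ Σ (Fin (length ρ)) λ c → (lookup ρ c ≡ b) × (lookup π (idx o c) < x)

  -- x < v_b
  ValBelow : ℕ → ℕ → Set
  ValBelow b x = b ≡ suc (length ρ) ⊎ Σ (Fin (length ρ)) λ c → (lookup ρ c ≡ b) × (x < lookup π (idx o c))

  BoxEmpty : ℕ × ℕ → Set
  BoxEmpty (a , b) = (j : Fin (length π)) →
    ¬ (PosAbove a (suc (toℕ j)) × PosBelow (suc a) (suc (toℕ j)) ×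
       ValAbove b (lookup π j) × ValBelow (suc b) (lookup π j))

MeshContains : List ℕ → List ℕ → List (ℕ × ℕ) → Set
MeshContains π ρ A = Σ (Occurrence π ρ) λ o → ∀ {ab} → ab ∈ A → BoxEmpty o ab

Avoids : List ℕ → List ℕ → Set
Avoids π ρ = ¬ Contains π ρ

AvoidsMesh : List ℕ → List ℕ → List (ℕ × ℕ) → Set
AvoidsMesh π ρ A = ¬ MeshContains π ρ A

mu2413-shading : List (ℕ × ℕ)
mu2413-shading = (1 , 0) ∷ (2 , 1) ∷ (2 , 2) ∷ []

{-# OPTIONS --safe #-}
-- The stack of 𝔰 = 𝔰_{\underline{23}1}, read from the top, never contains \underline{23}1, so an incoming
-- t pops the top s exactly when t < s and some entry below s is smaller than t.  Consequently an entry
-- a stays on the stack at least until its next smaller entry e arrives; then a is popped if some entry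
-- before e is smaller than e, and is never popped otherwise; and the minimum of the stack after w has
-- been pushed leaves after every later entry.  Following a 231 of 𝔰(τ) back through these rules shows
-- that 𝔰(τ) contains 231 exactly when τ contains an entry x followed by its next smaller entry e, an
-- entry y > x after e and an entry w < e before e (a 1324), or entries z, y, x in this order with
-- z < x < y where the next smaller entry of y is a left-to-right minimum (an occurrence of μ₂₄₁₃).
-- Finally, West's stack-sorting map sorts exactly the 231-avoiding permutations.
module Submission where

open import Defs

open import Data.Bool using (Bool; true; false; if_then_else_; T; _∧_)
open import Data.Bool.ListAction using (any)
open import Data.Bool.Properties using (T-≡; T-∨; T-∧)
open import Data.Empty using (⊥; ⊥-elim)
open import Data.Fin using (Fin; zero; suc; toℕ; #_)
open import Data.Fin.Properties using (toℕ-injective; toℕ<n)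
open import Data.List using (List; []; _∷_; _++_; length; lookup)
open import Data.List.Membership.Propositional using (_∈_; _∉_; find; lose)
open import Data.List.Membership.Propositional.Properties using (∈-++⁺ˡ; ∈-++⁺ʳ; ∈-++⁻; ∈-∃++; ∈-lookup)
open import Data.List.Properties using (++-assoc; ++-identityʳ)
open import Data.List.Relation.Binary.Permutation.Propositional
  using (_↭_; ↭⇒↭ₛ; ↭-refl; ↭-reflexive; ↭-sym; ↭-trans)
open import Data.List.Relation.Binary.Permutation.Propositional.Properties using (shift; ++⁺ˡ; ∈-resp-↭; All-resp-↭)
import Data.List.Relation.Binary.Permutation.Setoid.Properties as PermutationSetoid
open import Data.List.Relation.Binary.Pointwise using (Pointwise-≡⇒≡)
open import Data.List.Relation.Unary.All using (All; []; _∷_)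
import Data.List.Relation.Unary.All as All
import Data.List.Relation.Unary.All.Properties as All
open import Data.List.Relation.Unary.AllPairs using (AllPairs; []; _∷_)
import Data.List.Relation.Unary.AllPairs as AllPairs
import Data.List.Relation.Unary.AllPairs.Properties as AllPairs
open import Data.List.Relation.Unary.Any as Any using (Any; here; there; any?)
open import Data.List.Relation.Unary.Any.Properties using (lookup-index; any⁺; any⁻; ¬Any[]) renaming (++⁺ʳ to Any-++⁺ʳ)
open import Data.List.Relation.Unary.First using (first)
import Data.List.Relation.Unary.First as First
open import Data.List.Relation.Unary.First.Properties using (toView)
open import Data.List.Relation.Unary.Linked using (Linked; []; [-]; _∷_)
open import Data.List.Relation.Unary.Linked.Properties using (Linked⇒AllPairs)
open import Data.List.Relation.Unary.Sorted.TotalOrder using (Sorted)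
open import Data.List.Relation.Unary.Sorted.TotalOrder.Properties using (AllPairs⇒Sorted; ↗↭↗⇒≋)
open import Data.List.Relation.Unary.Unique.Propositional using (Unique)
open import Data.List.Relation.Unary.Unique.Propositional.Properties using (Unique[x∷xs]⇒x∉xs)
open import Data.Nat using (ℕ; zero; suc; _<_; _≤_; _<?_; _≟_; _<ᵇ_; s≤s; s<s; s<s⁻¹)
open import Data.Nat.Properties
  using (<-asym; <-irrefl; <-cmp; <-trans; ≤-refl; ≤-trans; ≤-<-trans; <-≤-trans; <⇒≤; <⇒≢; >⇒≢; <⇒≱; ≮⇒≥; ≰⇒>;
         ≤∧≢⇒<; _≤?_; ≤-<-connex; suc-injective; <ᵇ⇒<; <⇒<ᵇ; ≤-totalOrder)
open import Data.List.Relation.Unary.Unique.DecPropositional _≟_ using (unique?)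
open import Data.Product using (Σ; _×_; _,_; ∃; ∃₂; proj₁; proj₂; uncurry)
open import Data.Sum using (_⊎_; inj₁; inj₂; [_,_]′)
import Data.Sum as Sum
open import Data.Sum.Function.Propositional using (_⊎-⇔_)
open import Function using (_∘_; _⇔_; mk⇔; Equivalence; _on_)
open import Function.Properties.Equivalence using () renaming (trans to ⇔-trans; sym to ⇔-sym)
open import Function.Related.TypeIsomorphisms using (¬-cong-⇔)
open import Relation.Binary using (Tri; tri<; tri≈; tri>)
open import Relation.Binary.Construct.Closure.Reflexive using (ReflClosure; refl; [_])
open import Relation.Binary.PropositionalEquality
  using (_≡_; _≢_; refl; sym; trans; cong; subst; subst₂; setoid; module ≡-Reasoning)
open import Relation.Nullary using (¬_; yes; no)
open import Relation.Nullary.Decidable using (True; toWitness)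
open import Relation.Nullary.Negation using (_¬-⊎_)

-- Relative positions of entries in a list

module _ {A : Set} where

  unique-++-disjoint : ∀ {xs ys : List A} → Unique (xs ++ ys) → ∀ {v} → v ∈ xs → v ∉ ys
  unique-++-disjoint {x ∷ xs} (x∉ ∷ _) (here refl) v∈ys = All.lookup (All.++⁻ʳ xs x∉) v∈ys refl
  unique-++-disjoint {x ∷ xs} (_ ∷ u) (there v∈) = unique-++-disjoint u v∈

  unique-++ˡ : ∀ (xs : List A) {ys} → Unique (xs ++ ys) → Unique xs
  unique-++ˡ [] _ = []
  unique-++ˡ (x ∷ xs) (x∉ ∷ u) = All.++⁻ˡ xs x∉ ∷ unique-++ˡ xs u

  unique-++ʳ : ∀ (xs : List A) {ys} → Unique (xs ++ ys) → Unique ys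
  unique-++ʳ [] u = u
  unique-++ʳ (x ∷ xs) (_ ∷ u) = unique-++ʳ xs u

  unique-resp-↭ : ∀ {xs ys : List A} → xs ↭ ys → Unique xs → Unique ys
  unique-resp-↭ p = PermutationSetoid.Unique-resp-↭ (setoid A) (↭⇒↭ₛ p)

  data Precedes : List A → A → A → Set where
    head : ∀ {a b xs} → b ∈ xs → Precedes (a ∷ xs) a b
    tail : ∀ {x a b xs} → Precedes xs a b → Precedes (x ∷ xs) a b

  PrecedesOrEq : List A → A → A → Set
  PrecedesOrEq xs = ReflClosure (Precedes xs)

  precedes-∈ˡ : ∀ {xs a b} → Precedes xs a b → a ∈ xs
  precedes-∈ˡ (head _) = here refl
  precedes-∈ˡ (tail p) = there (precedes-∈ˡ p)

  precedes-∈ʳ : ∀ {xs a b} → Precedes xs a b → b ∈ xs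
  precedes-∈ʳ (head b∈) = there b∈
  precedes-∈ʳ (tail p) = there (precedes-∈ʳ p)

  precedes-total : ∀ {xs a b} → a ∈ xs → b ∈ xs → a ≢ b → Precedes xs a b ⊎ Precedes xs b a
  precedes-total (here refl) (here refl) a≢b = ⊥-elim (a≢b refl)
  precedes-total (here refl) (there b∈) _ = inj₁ (head b∈)
  precedes-total (there a∈) (here refl) _ = inj₂ (head a∈)
  precedes-total (there a∈) (there b∈) a≢b with precedes-total a∈ b∈ a≢b
  ... | inj₁ p = inj₁ (tail p)
  ... | inj₂ p = inj₂ (tail p)

  precedes-≢ : ∀ {xs a b} → Unique xs → Precedes xs a b → a ≢ b
  precedes-≢ u (head b∈) refl = Unique[x∷xs]⇒x∉xs u b∈
  precedes-≢ (_ ∷ u) (tail p) = precedes-≢ u p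

  precedes-irrefl : ∀ {xs a} → Unique xs → ¬ Precedes xs a a
  precedes-irrefl u p = precedes-≢ u p refl

  precedes-asym : ∀ {xs a b} → Unique xs → Precedes xs a b → ¬ Precedes xs b a
  precedes-asym u (head b∈) (head _) = Unique[x∷xs]⇒x∉xs u b∈
  precedes-asym u (head _) (tail q) = Unique[x∷xs]⇒x∉xs u (precedes-∈ʳ q)
  precedes-asym u (tail p) (head _) = Unique[x∷xs]⇒x∉xs u (precedes-∈ʳ p)
  precedes-asym (_ ∷ u) (tail p) (tail q) = precedes-asym u p q

  precedes-trans : ∀ {xs a b c} → Unique xs → Precedes xs a b → Precedes xs b c → Precedes xs a c
  precedes-trans u (head b∈) (head _) = ⊥-elim (Unique[x∷xs]⇒x∉xs u b∈)
  precedes-trans _ (head _) (tail q) = head (precedes-∈ʳ q)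
  precedes-trans u (tail p) (head _) = ⊥-elim (Unique[x∷xs]⇒x∉xs u (precedes-∈ʳ p))
  precedes-trans (_ ∷ u) (tail p) (tail q) = tail (precedes-trans u p q)

  precedes-ordered : ∀ {xs a b} → a ∈ xs → b ∈ xs → a ≢ b → ¬ Precedes xs b a → Precedes xs a b
  precedes-ordered a∈ b∈ a≢b ¬ba with precedes-total a∈ b∈ a≢b
  ... | inj₁ ab = ab
  ... | inj₂ ba = ⊥-elim (¬ba ba)

  module _ {xs : List A} (u : Unique xs) where

    precedesOrEq-precedes : ∀ {a b c} → PrecedesOrEq xs a b → Precedes xs b c → Precedes xs a c
    precedesOrEq-precedes refl q = q
    precedesOrEq-precedes [ p ] q = precedes-trans u p q

    precedes-precedesOrEq : ∀ {a b c} → Precedes xs a b → PrecedesOrEq xs b c → Precedes xs a c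
    precedes-precedesOrEq p refl = p
    precedes-precedesOrEq p [ q ] = precedes-trans u p q

  precedes⇒AllPairs : ∀ {R : A → A → Set} xs → (∀ {x y} → Precedes xs x y → R x y) → AllPairs R xs
  precedes⇒AllPairs [] _ = []
  precedes⇒AllPairs (x ∷ xs) R-ordered = All.tabulate (R-ordered ∘ head) ∷ precedes⇒AllPairs xs (R-ordered ∘ tail)

  AllPairs⇒precedes : ∀ {R : A → A → Set} {xs x y} → AllPairs R xs → Precedes xs x y → R x y
  AllPairs⇒precedes (Rx ∷ _) (head y∈) = All.lookup Rx y∈
  AllPairs⇒precedes (_ ∷ pairs) (tail p) = AllPairs⇒precedes pairs p

  precedesOrEq∧≢⇒precedes : ∀ {xs a b} → PrecedesOrEq xs a b → a ≢ b → Precedes xs a b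
  precedesOrEq∧≢⇒precedes refl a≢a = ⊥-elim (a≢a refl)
  precedesOrEq∧≢⇒precedes [ a≺b ] _ = a≺b

  Adjacent : List A → A → A → Set
  Adjacent xs a b = Precedes xs a b × (∀ {c} → Precedes xs a c → ¬ Precedes xs c b)

  precedes-++ʳ : ∀ xs {ys a b} → Precedes ys a b → Precedes (xs ++ ys) a b
  precedes-++ʳ [] p = p
  precedes-++ʳ (x ∷ xs) p = tail (precedes-++ʳ xs p)

  precedes-++ : ∀ xs {ys a b} → a ∈ xs → b ∈ ys → Precedes (xs ++ ys) a b
  precedes-++ (x ∷ xs) (here refl) b∈ = head (∈-++⁺ʳ xs b∈)
  precedes-++ (x ∷ xs) (there a∈) b∈ = tail (precedes-++ xs a∈ b∈)

  precedes-insert : ∀ xs {ys t a b} → Precedes (xs ++ ys) a b → Precedes (xs ++ t ∷ ys) a b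
  precedes-insert [] p = tail p
  precedes-insert (x ∷ xs) (head b∈) with ∈-++⁻ xs b∈
  ... | inj₁ b∈xs = head (∈-++⁺ˡ b∈xs)
  ... | inj₂ b∈ys = head (∈-++⁺ʳ xs (there b∈ys))
  precedes-insert (x ∷ xs) (tail p) = tail (precedes-insert xs p)

  precedes-split : ∀ {xs a b} → Precedes xs a b → ∃₂ λ p q → ∃ λ r → xs ≡ p ++ a ∷ q ++ b ∷ r
  precedes-split (head b∈) with ∈-∃++ b∈
  ... | q , r , refl = [] , q , r , refl
  precedes-split {x ∷ _} (tail pr) with precedes-split pr
  ... | p , q , r , refl = x ∷ p , q , r , refl

  pivot-precedes : ∀ p {a q c} → c ∈ q → Precedes (p ++ a ∷ q) a c
  pivot-precedes p c∈ = precedes-++ʳ p (head c∈)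

  precedes-pivot : ∀ p {a q c} → c ∈ p → Precedes (p ++ a ∷ q) c a
  precedes-pivot p c∈ = precedes-++ p c∈ (here refl)

  pivot-precedes⁻ : ∀ p {a q c} → Unique (p ++ a ∷ q) → Precedes (p ++ a ∷ q) a c → c ∈ q
  pivot-precedes⁻ [] _ (head c∈) = c∈
  pivot-precedes⁻ [] u (tail pr) = ⊥-elim (Unique[x∷xs]⇒x∉xs u (precedes-∈ˡ pr))
  pivot-precedes⁻ (x ∷ p) u (head _) = ⊥-elim (Unique[x∷xs]⇒x∉xs u (∈-++⁺ʳ p (here refl)))
  pivot-precedes⁻ (x ∷ p) (_ ∷ u) (tail pr) = pivot-precedes⁻ p u pr

  precedes-pivot⁻ : ∀ p {a q c} → Unique (p ++ a ∷ q) → Precedes (p ++ a ∷ q) c a → c ∈ p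
  precedes-pivot⁻ [] u (head a∈) = ⊥-elim (Unique[x∷xs]⇒x∉xs u a∈)
  precedes-pivot⁻ [] u (tail pr) = ⊥-elim (Unique[x∷xs]⇒x∉xs u (precedes-∈ʳ pr))
  precedes-pivot⁻ (x ∷ p) _ (head _) = here refl
  precedes-pivot⁻ (x ∷ p) (_ ∷ u) (tail pr) = there (precedes-pivot⁻ p u pr)

  module _ (p : List A) {a : A} {q : List A} {b : A} {r : List A} where

    private
      reassoc : p ++ a ∷ q ++ b ∷ r ≡ (p ++ a ∷ q) ++ b ∷ r
      reassoc = sym (++-assoc p (a ∷ q) (b ∷ r))

    before-second⁺ : ∀ {c} → c ∈ p ++ a ∷ q → Precedes (p ++ a ∷ q ++ b ∷ r) c b
    before-second⁺ c∈ = subst (λ xs → Precedes xs _ b) (sym reassoc) (precedes-pivot (p ++ a ∷ q) c∈)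

    between-All : ∀ {P : A → Set} →
      (∀ {c} → Precedes (p ++ a ∷ q ++ b ∷ r) a c → Precedes (p ++ a ∷ q ++ b ∷ r) c b → P c) → All P q
    between-All P-between =
      All.tabulate λ c∈ → P-between (pivot-precedes p (∈-++⁺ˡ c∈)) (before-second⁺ (∈-++⁺ʳ p (there c∈)))

    after-second⁻ : ∀ {c} → Unique (p ++ a ∷ q ++ b ∷ r) → Precedes (p ++ a ∷ q ++ b ∷ r) b c → c ∈ r
    after-second⁻ u pr rewrite reassoc = pivot-precedes⁻ (p ++ a ∷ q) u pr

    before-second⁻ : ∀ {c} → Unique (p ++ a ∷ q ++ b ∷ r) → Precedes (p ++ a ∷ q ++ b ∷ r) c b → c ∈ p ++ a ∷ q
    before-second⁻ u pr rewrite reassoc = precedes-pivot⁻ (p ++ a ∷ q) u pr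

    between⁻ : ∀ {c} → Unique (p ++ a ∷ q ++ b ∷ r) →
      Precedes (p ++ a ∷ q ++ b ∷ r) a c → Precedes (p ++ a ∷ q ++ b ∷ r) c b → c ∈ q
    between⁻ u ac cb with ∈-++⁻ q (pivot-precedes⁻ p u ac)
    ... | inj₁ c∈q = c∈q
    ... | inj₂ (here refl) = ⊥-elim (precedes-irrefl u cb)
    ... | inj₂ (there c∈r) =
      ⊥-elim (unique-++-disjoint (subst Unique reassoc u) (before-second⁻ u cb) (there c∈r))

    after-second-or-eq⁻ : ∀ {c} → Unique (p ++ a ∷ q ++ b ∷ r) →
      PrecedesOrEq (p ++ a ∷ q ++ b ∷ r) b c → c ∈ b ∷ r
    after-second-or-eq⁻ _ refl = here refl
    after-second-or-eq⁻ u [ b≺c ] = there (after-second⁻ u b≺c)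

  predecessor-split : ∀ {xs a b} → Precedes xs a b → ∃₂ λ p r → ∃ λ a′ → xs ≡ p ++ a′ ∷ b ∷ r
  predecessor-split (head b∈) = last-before b∈
    where
    last-before : ∀ {x xs b} → b ∈ xs → ∃₂ λ p r → ∃ λ a′ → x ∷ xs ≡ p ++ a′ ∷ b ∷ r
    last-before (here refl) = [] , _ , _ , refl
    last-before {x} (there b∈) with last-before b∈
    ... | p , r , a′ , eq = x ∷ p , r , a′ , cong (x ∷_) eq
  predecessor-split {x ∷ _} (tail pr) with predecessor-split pr
  ... | p , r , a′ , refl = x ∷ p , r , a′ , refl

Has231 : List ℕ → Set
Has231 xs = Σ ℕ λ x → Σ ℕ λ y → Σ ℕ λ z → Precedes xs x y × Precedes xs y z × z < x × x < y

Has1324 : List ℕ → Set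
Has1324 τ = Σ ℕ λ a → Σ ℕ λ c → Σ ℕ λ b → Σ ℕ λ d →
  Precedes τ a c × Precedes τ c b × Precedes τ b d × a < b × b < c × c < d

-- The last two conjuncts say that the shaded boxes (1,0) and (2,1), (2,2) of μ₂₄₁₃ are empty.
HasMesh2413 : List ℕ → Set
HasMesh2413 τ = Σ ℕ λ p → Σ ℕ λ q → Σ ℕ λ r → Σ ℕ λ s →
  Precedes τ p q × Precedes τ q r × Precedes τ r s × r < p × p < s × s < q ×
  (∀ {c} → Precedes τ p c → Precedes τ c q → r ≤ c) ×
  (∀ {c} → Precedes τ q c → Precedes τ c r → r < c → s ≤ c)

-- An incoming t pops the top s of the stack s ∷ st as long as pops t s st holds.
-- A state is the stack, top first, together with the output so far.
module StackMachine (pops : ℕ → ℕ → List ℕ → Bool) where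

  State : Set
  State = List ℕ × List ℕ

  stack output : State → List ℕ
  stack = proj₁
  output = proj₂

  kept : ℕ → List ℕ → List ℕ
  kept t [] = []
  kept t (s ∷ st) = if pops t s st then kept t st else s ∷ st

  popped : ℕ → List ℕ → List ℕ
  popped t [] = []
  popped t (s ∷ st) = if pops t s st then s ∷ popped t st else []

  step : ℕ → State → State
  step t (st , out) = t ∷ kept t st , out ++ popped t st

  run : List ℕ → State → State
  run [] σ = σ
  run (t ∷ ts) σ = run ts (step t σ)

  flush : State → List ℕ
  flush (st , out) = out ++ st

  start : State
  start = [] , []

  result : List ℕ → List ℕ
  result τ = flush (run τ start)

  popped++kept : ∀ t st → popped t st ++ kept t st ≡ st
  popped++kept t [] = refl
  popped++kept t (s ∷ st) with pops t s st
  ... | true = cong (s ∷_) (popped++kept t st)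
  ... | false = refl

  ∈-popped⊎kept : ∀ {x} t st → x ∈ st → x ∈ popped t st ⊎ x ∈ kept t st
  ∈-popped⊎kept {x} t st x∈ = ∈-++⁻ (popped t st) (subst (x ∈_) (sym (popped++kept t st)) x∈)

  run-++ : ∀ xs ys σ → run (xs ++ ys) σ ≡ run ys (run xs σ)
  run-++ [] ys σ = refl
  run-++ (x ∷ xs) ys σ = run-++ xs ys (step x σ)

  result-pivot : ∀ p a r → result (p ++ a ∷ r) ≡ flush (run r (step a (run p start)))
  result-pivot p a r = cong flush (run-++ p (a ∷ r) start)

  flush-before-step : ∀ t st out → flush (st , out) ≡ (out ++ popped t st) ++ kept t st
  flush-before-step t st out = begin
    out ++ st                            ≡⟨ cong (out ++_) (popped++kept t st) ⟨
    out ++ popped t st ++ kept t st      ≡⟨ ++-assoc out (popped t st) (kept t st) ⟨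
    (out ++ popped t st) ++ kept t st    ∎
    where open ≡-Reasoning

  flush-step-↭ : ∀ t σ → flush (step t σ) ↭ t ∷ flush σ
  flush-step-↭ t (st , out) = ↭-trans (shift t (out ++ popped t st) (kept t st))
    (↭-reflexive (cong (t ∷_) (sym (flush-before-step t st out))))

  flush-run-↭ : ∀ q σ → flush (run q σ) ↭ q ++ flush σ
  flush-run-↭ [] σ = ↭-refl
  flush-run-↭ (t ∷ q) σ = ↭-trans (flush-run-↭ q (step t σ))
    (↭-trans (++⁺ˡ q (flush-step-↭ t σ)) (shift t q (flush σ)))

  result-↭ : ∀ τ → result τ ↭ τ
  result-↭ τ = ↭-trans (flush-run-↭ τ start) (↭-reflexive (++-identityʳ τ))

  result-unique : ∀ {τ} → Unique τ → Unique (result τ)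
  result-unique {τ} = unique-resp-↭ (↭-sym (result-↭ τ))

  ∈-input⇒∈result : ∀ τ {x} → x ∈ τ → x ∈ result τ
  ∈-input⇒∈result τ = ∈-resp-↭ (↭-sym (result-↭ τ))

  order-in-input : ∀ {τ x y} → Precedes (result τ) x y → x ≢ y → Precedes τ x y ⊎ Precedes τ y x
  order-in-input {τ} x≺y = precedes-total (∈-resp-↭ (result-↭ τ) (precedes-∈ˡ x≺y)) (∈-resp-↭ (result-↭ τ) (precedes-∈ʳ x≺y))

  ∈-stack⇒∈input : ∀ τ {x} → x ∈ stack (run τ start) → x ∈ τ
  ∈-stack⇒∈input τ x∈ = ∈-resp-↭ (result-↭ τ) (∈-++⁺ʳ (output (run τ start)) x∈)

  run-snoc : ∀ q b r σ → run (q ++ b ∷ r) σ ≡ run r (run (q ++ b ∷ []) σ)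
  run-snoc q b r σ = trans (cong (λ l → run l σ) (sym (++-assoc q (b ∷ []) r))) (run-++ (q ++ b ∷ []) r σ)

  precedes-step : ∀ {x y} t σ → Precedes (flush σ) x y → Precedes (flush (step t σ)) x y
  precedes-step {x} {y} t (st , out) p =
    precedes-insert (out ++ popped t st) (subst (λ l → Precedes l x y) (flush-before-step t st out) p)

  precedes-run : ∀ {x y} q σ → Precedes (flush σ) x y → Precedes (flush (run q σ)) x y
  precedes-run [] σ p = p
  precedes-run (t ∷ q) σ p = precedes-run q (step t σ) (precedes-step t σ p)

  output-precedes-run : ∀ {x b} q σ → x ∈ output σ → b ∈ q → Precedes (flush (run q σ)) x b
  output-precedes-run (t ∷ q) (st , out) x∈ (here refl) =
    precedes-run q (step t (st , out)) (precedes-++ (out ++ popped t st) (∈-++⁺ˡ x∈) (here refl))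
  output-precedes-run (t ∷ q) (st , out) x∈ (there b∈) =
    output-precedes-run q (step t (st , out)) (∈-++⁺ˡ x∈) b∈

  popped-precedes-run : ∀ {a b} t σ q → a ∈ popped t (stack σ) → b ∈ t ∷ q → Precedes (flush (run (t ∷ q) σ)) a b
  popped-precedes-run t (st , out) q a∈ (here refl) =
    precedes-run q (step t (st , out)) (precedes-++ (out ++ popped t st) (∈-++⁺ʳ out a∈) (here refl))
  popped-precedes-run t (st , out) q a∈ (there b∈) =
    output-precedes-run q (step t (st , out)) (∈-++⁺ʳ out a∈) b∈

  Stays : State → ℕ → List ℕ → Set
  Stays σ a [] = a ∈ stack σ
  Stays σ a (t ∷ q) = a ∈ stack σ × Stays (step t σ) a q

  stays-now : ∀ {σ a} q → Stays σ a q → a ∈ stack σ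
  stays-now [] s = s
  stays-now (t ∷ q) (s , _) = s

  stays-last : ∀ {σ a} q → Stays σ a q → a ∈ stack (run q σ)
  stays-last [] s = s
  stays-last (t ∷ q) (_ , s) = stays-last q s

  stays-++ : ∀ {σ a} q₁ q₂ → Stays σ a q₁ → Stays (run q₁ σ) a q₂ → Stays σ a (q₁ ++ q₂)
  stays-++ [] q₂ _ s₂ = s₂
  stays-++ (t ∷ q₁) q₂ (h , s₁) s₂ = h , stays-++ q₁ q₂ s₁ s₂

  stays-precedes : ∀ {σ a b} q → Stays σ a q → b ∈ q → a ≢ b → Precedes (flush (run q σ)) b a
  stays-precedes {st , out} (t ∷ q) (_ , s) (here refl) a≢t with stays-now q s
  ... | here a≡t = ⊥-elim (a≢t a≡t)
  ... | there a∈ = precedes-run q (step t (st , out)) (precedes-++ʳ (out ++ popped t st) (head a∈))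
  stays-precedes (t ∷ q) (_ , s) (there b∈) a≢b = stays-precedes q s b∈ a≢b

  kept-past : ∀ t u {a v} → pops t a v ≡ false →
    Σ (List ℕ) λ u′ → kept t (u ++ a ∷ v) ≡ u′ ++ a ∷ v × (∀ {x} → x ∈ u′ → x ∈ u)
  kept-past t [] e rewrite e = [] , refl , λ ()
  kept-past t (s ∷ u) {a} {v} e with pops t s (u ++ a ∷ v)
  ... | false = s ∷ u , refl , λ x∈ → x∈
  ... | true with kept-past t u e
  ...   | u′ , eq , sub = u′ , eq , λ x∈ → there (sub x∈)

  module _ {a : ℕ} {v : List ℕ} where

    stays-unpopped : ∀ q u out → (∀ {t} → t ∈ q → pops t a v ≡ false) →
      ∀ {x} → x ∈ a ∷ v → Stays (u ++ a ∷ v , out) x q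
    stays-unpopped [] u out _ x∈ = ∈-++⁺ʳ u x∈
    stays-unpopped (t ∷ q) u out unpopped x∈ with kept-past t u (unpopped (here refl))
    ... | u′ , eq , _ rewrite eq =
      ∈-++⁺ʳ u x∈ , stays-unpopped q (t ∷ u′) _ (λ t∈ → unpopped (there t∈)) x∈

    stack-unpopped : ∀ {P : ℕ → Set} q u out → (∀ {t} → t ∈ q → pops t a v ≡ false) → All P q → All P u →
      Σ (List ℕ) λ u′ → stack (run q (u ++ a ∷ v , out)) ≡ u′ ++ a ∷ v × All P u′
    stack-unpopped [] u out _ _ Pu = u , refl , Pu
    stack-unpopped (t ∷ q) u out unpopped (Pt ∷ Pq) Pu with kept-past t u (unpopped (here refl))
    ... | u′ , eq , u′⊆u rewrite eq =
      stack-unpopped q (t ∷ u′) _ (λ t∈ → unpopped (there t∈)) Pq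
        (Pt ∷ All.tabulate (λ x∈ → All.lookup Pu (u′⊆u x∈)))

-- West's stack-sorting map

module West where


  pops : ℕ → ℕ → List ℕ → Bool
  pops t s _ = s <ᵇ t

  open StackMachine pops public

  westPop≡ : ∀ t st out → westPop t st out ≡ (kept t st , out ++ popped t st)
  westPop≡ t [] out = cong ([] ,_) (sym (++-identityʳ out))
  westPop≡ t (s ∷ st) out with s <ᵇ t
  ... | true = trans (westPop≡ t st (out ++ s ∷ [])) (cong (kept t st ,_) (++-assoc out (s ∷ []) (popped t st)))
  ... | false = cong (s ∷ st ,_) (sym (++-identityʳ out))

  westRun≡ : ∀ ts st out → westRun ts st out ≡ flush (run ts (st , out))
  westRun≡ [] st out = refl
  westRun≡ (t ∷ ts) st out rewrite westPop≡ t st out = westRun≡ ts (t ∷ kept t st) (out ++ popped t st)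

  westSort≡result : ∀ τ → westSort τ ≡ result τ
  westSort≡result τ = westRun≡ τ [] []

  kept-sorted : ∀ t st → AllPairs _≤_ st → All (t ≤_) (kept t st) × AllPairs _≤_ (kept t st)
  kept-sorted t [] _ = [] , []
  kept-sorted t (s ∷ st) (s≤st ∷ sorted) with s <ᵇ t in eq
  ... | true = kept-sorted t st sorted
  ... | false = (t≤s ∷ All.map (≤-trans t≤s) s≤st) , (s≤st ∷ sorted)
    where
    t≤s : t ≤ s
    t≤s = ≮⇒≥ λ s<t → subst T eq (<⇒<ᵇ s<t)

  stack-sorted : ∀ q σ → AllPairs _≤_ (stack σ) → AllPairs _≤_ (stack (run q σ))
  stack-sorted [] σ sorted = sorted
  stack-sorted (t ∷ q) σ sorted with kept-sorted t (stack σ) sorted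
  ... | t≤kept , kept-sorted′ = stack-sorted q (step t σ) (t≤kept ∷ kept-sorted′)

  <ᵇ-true : ∀ {m n} → m < n → (m <ᵇ n) ≡ true
  <ᵇ-true m<n = Equivalence.to T-≡ (<⇒<ᵇ m<n)

  <ᵇ-false : ∀ {m n} → ¬ m < n → (m <ᵇ n) ≡ false
  <ᵇ-false {m} {n} m≮n with m <ᵇ n in eq
  ... | true = ⊥-elim (m≮n (<ᵇ⇒< m n (subst T (sym eq) _)))
  ... | false = refl

  pop-smaller : ∀ t u {a v} → AllPairs _≤_ (u ++ a ∷ v) → a < t → a ∈ popped t (u ++ a ∷ v)
  pop-smaller t [] _ a<t rewrite <ᵇ-true a<t = here refl
  pop-smaller t (s ∷ u) (s≤ ∷ sorted) a<t
    rewrite <ᵇ-true (≤-<-trans (All.lookup s≤ (∈-++⁺ʳ u (here refl))) a<t) = there (pop-smaller t u sorted a<t)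

  module _ {τ : List ℕ} (u : Unique τ) where

    west-flips-over-smaller : ∀ {a b} → Precedes τ a b → (∀ {c} → Precedes τ a c → PrecedesOrEq τ c b → c < a) →
      Precedes (result τ) b a
    west-flips-over-smaller {a} {b} a≺b smaller with precedes-split a≺b
    ... | p , q , r , refl rewrite result-pivot p a (q ++ b ∷ r) | run-snoc q b r (step a (run p start)) =
      precedes-run r _ (stays-precedes (q ++ b ∷ []) stays (∈-++⁺ʳ q (here refl)) (precedes-≢ u a≺b))
      where
      q<a : All (_< a) (q ++ b ∷ [])
      q<a = All.++⁺ (between-All p λ a≺c c≺b → smaller a≺c [ c≺b ]) (smaller a≺b refl ∷ [])
      stays : Stays (step a (run p start)) a (q ++ b ∷ [])
      stays = stays-unpopped (q ++ b ∷ []) [] _ (λ t∈ → <ᵇ-false (<-asym (All.lookup q<a t∈))) (here refl)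

    west-popped-by-larger : ∀ {a c b} → Precedes τ a c → a < c → PrecedesOrEq τ c b → Precedes (result τ) a b
    west-popped-by-larger {a} {c} {b} a≺c a<c c≼b with precedes-split a≺c
    ... | p , q , r , refl rewrite result-pivot p a (q ++ c ∷ r) | run-++ q (c ∷ r) (step a (run p start)) =
      go (∈-++⁻ (output σ₁) a∈σ₁)
      where
      σ₁ = run q (step a (run p start))
      a∈σ₁ : a ∈ flush σ₁
      a∈σ₁ = ∈-resp-↭ (↭-sym (flush-run-↭ (a ∷ q) (run p start))) (here refl)
      b∈ : b ∈ c ∷ r
      b∈ = after-second-or-eq⁻ p u c≼b
      go : a ∈ output σ₁ ⊎ a ∈ stack σ₁ → Precedes (flush (run (c ∷ r) σ₁)) a b
      go (inj₁ a∈out) = output-precedes-run (c ∷ r) σ₁ a∈out b∈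
      go (inj₂ a∈stack) with ∈-∃++ a∈stack
      ... | us , vs , stack≡ = popped-precedes-run c σ₁ r (subst (λ st → a ∈ popped c st) (sym stack≡) a∈popped) b∈
        where
        sorted : AllPairs _≤_ (us ++ a ∷ vs)
        sorted = subst (AllPairs _≤_) stack≡ (stack-sorted (a ∷ q) (run p start) (stack-sorted p start []))
        a∈popped = pop-smaller c us sorted a<c

    west-ordered : ¬ Has231 τ → ∀ {x y} → Precedes (result τ) x y → x < y
    west-ordered no231 {x} {y} x≺y with <-cmp x y
    ... | tri< x<y _ _ = x<y
    ... | tri≈ _ x≡y _ = ⊥-elim (precedes-≢ (result-unique u) x≺y x≡y)
    ... | tri> _ _ y<x with order-in-input x≺y (>⇒≢ y<x)
    ...   | inj₂ y≺x = ⊥-elim (precedes-asym (result-unique u) x≺y (west-popped-by-larger y≺x y<x refl))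
    ...   | inj₁ x≺′y = ⊥-elim (precedes-asym (result-unique u) x≺y (west-flips-over-smaller x≺′y smaller))
      where
      smaller : ∀ {c} → Precedes τ x c → PrecedesOrEq τ c y → c < x
      smaller x≺c refl = y<x
      smaller {c} x≺c [ c≺y ] with <-cmp c x
      ... | tri< c<x _ _ = c<x
      ... | tri≈ _ c≡x _ = ⊥-elim (precedes-≢ u x≺c (sym c≡x))
      ... | tri> _ _ x<c = ⊥-elim (no231 (x , c , y , x≺c , c≺y , y<x , x<c))

  west-sorted⇔avoids231 : ∀ {τ} → Unique τ → AllPairs _<_ (result τ) ⇔ (¬ Has231 τ)
  west-sorted⇔avoids231 {τ} u = mk⇔
    (λ sorted (a , c , b , a≺c , c≺b , b<a , a<c) →
       <-asym b<a (AllPairs⇒precedes sorted (west-popped-by-larger u a≺c a<c [ c≺b ])))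
    (λ no231 → precedes⇒AllPairs (result τ) (west-ordered u no231))

-- Next smaller entries and left-to-right minima

FirstBelow : List ℕ → ℕ → ℕ → ℕ → Set
FirstBelow τ k a f = Precedes τ a f × f < k × (∀ {c} → Precedes τ a c → Precedes τ c f → k ≤ c)

NextSmaller : List ℕ → ℕ → ℕ → Set
NextSmaller τ a = FirstBelow τ a a

LeftToRightMinimum : List ℕ → ℕ → Set
LeftToRightMinimum τ e = ∀ {w} → Precedes τ w e → e < w

module _ {τ : List ℕ} (u : Unique τ) where

  first-below-after : ∀ k {a} → a ∈ τ → (Σ ℕ λ f → FirstBelow τ k a f) ⊎ (∀ {c} → Precedes τ a c → k ≤ c)
  first-below-after k a∈ with ∈-∃++ a∈
  ... | p , s , refl with first (≤-<-connex k) s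
  ...   | inj₂ k≤s = inj₂ λ a≺c → All.lookup k≤s (pivot-precedes⁻ p u a≺c)
  ...   | inj₁ fst with toView fst
  ...     | k≤xs First.++ f<k ∷ ys =
    inj₁ (_ , pivot-precedes p (∈-++⁺ʳ _ (here refl)) , f<k , λ a≺c c≺f → All.lookup k≤xs (between⁻ p u a≺c c≺f))

  first-below-until : ∀ k {a b} → Precedes τ a b →
    (Σ ℕ λ f → FirstBelow τ k a f × PrecedesOrEq τ f b) ⊎ (∀ {c} → Precedes τ a c → PrecedesOrEq τ c b → k ≤ c)
  first-below-until k {a} {b} a≺b with first-below-after k (precedes-∈ˡ a≺b)
  ... | inj₂ none = inj₂ λ a≺c _ → none a≺c
  ... | inj₁ (f , below@(a≺f , _ , k≤between)) with f ≟ b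
  ...   | yes refl = inj₁ (f , below , refl)
  ...   | no f≢b with precedes-total (precedes-∈ʳ a≺f) (precedes-∈ʳ a≺b) f≢b
  ...     | inj₁ f≺b = inj₁ (f , below , [ f≺b ])
  ...     | inj₂ b≺f = inj₂ λ a≺c c≼b → k≤between a≺c (precedesOrEq-precedes u c≼b b≺f)

  first-below : ∀ k {a b} → Precedes τ a b → b < k → Σ ℕ λ f → FirstBelow τ k a f × PrecedesOrEq τ f b
  first-below k a≺b b<k with first-below-until k a≺b
  ... | inj₁ found = found
  ... | inj₂ none = ⊥-elim (<⇒≱ b<k (none a≺b refl))

  next-smaller : ∀ {a b} → Precedes τ a b → b < a → Σ ℕ λ e → NextSmaller τ a e × PrecedesOrEq τ e b
  next-smaller = first-below _

  first-below-unique : ∀ {k a f f′} → FirstBelow τ k a f → FirstBelow τ k a f′ → f ≡ f′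
  first-below-unique {f = f} {f′} (a≺f , f<k , k≤) (a≺f′ , f′<k , k≤′) with f ≟ f′
  ... | yes f≡f′ = f≡f′
  ... | no f≢f′ with precedes-total (precedes-∈ʳ a≺f) (precedes-∈ʳ a≺f′) f≢f′
  ...   | inj₁ f≺f′ = ⊥-elim (<⇒≱ f<k (k≤′ a≺f f≺f′))
  ...   | inj₂ f′≺f = ⊥-elim (<⇒≱ f′<k (k≤ a≺f′ f′≺f))

  left-to-right-minimum? : ∀ {e} → e ∈ τ → (Σ ℕ λ w → Precedes τ w e × w < e) ⊎ LeftToRightMinimum τ e
  left-to-right-minimum? {e} e∈ with ∈-∃++ e∈
  ... | p , r , refl with any? (_<? e) p
  ...   | yes smaller with find smaller
  ...     | w , w∈ , w<e = inj₁ (w , precedes-pivot p w∈ , w<e)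
  left-to-right-minimum? {e} e∈ | p , r , refl | no none =
    inj₂ λ w≺e → ≤∧≢⇒< (≮⇒≥ λ w<e → none (lose (precedes-pivot⁻ p u w≺e) w<e))
                       (λ e≡w → precedes-≢ u w≺e (sym e≡w))

  predecessor : ∀ {q f} → Precedes τ q f → Σ ℕ λ q′ → Adjacent τ q′ f × PrecedesOrEq τ q q′
  predecessor {q} {f} q≺f with predecessor-split q≺f
  ... | p′ , r′ , q′ , refl = q′ , adjacent , q≼q′
    where
    adjacent : Adjacent τ q′ f
    adjacent = precedes-++ʳ p′ (head (here refl)) , λ q′≺c c≺f → ¬Any[] (between⁻ p′ {q = []} u q′≺c c≺f)
    q≼q′ : PrecedesOrEq τ q q′
    q≼q′ with q ≟ q′
    ... | yes refl = refl
    ... | no q≢q′ with precedes-total (precedes-∈ˡ q≺f) (precedes-∈ˡ (proj₁ adjacent)) q≢q′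
    ...   | inj₁ q≺q′ = [ q≺q′ ]
    ...   | inj₂ q′≺q = ⊥-elim (proj₂ adjacent q′≺q q≺f)

-- The \underline{23}1-avoiding stack map 𝔰

pops-u23-1 : ℕ → ℕ → List ℕ → Bool
pops-u23-1 t s st = contains-u23-1 (t ∷ s ∷ st)

open StackMachine pops-u23-1

𝔰 : List ℕ → List ℕ
𝔰 = result

popWhile≡ : ∀ t st out → popWhile t st out ≡ (kept t st , out ++ popped t st)
popWhile≡ t [] out = cong ([] ,_) (sym (++-identityʳ out))
popWhile≡ t (s ∷ st) out with contains-u23-1 (t ∷ s ∷ st)
... | true = trans (popWhile≡ t st (out ++ s ∷ [])) (cong (kept t st ,_) (++-assoc out (s ∷ []) (popped t st)))
... | false = cong (s ∷ st ,_) (sym (++-identityʳ out))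

stackRun≡ : ∀ ts st out → stackRun ts st out ≡ flush (run ts (st , out))
stackRun≡ [] st out = refl
stackRun≡ (t ∷ ts) st out rewrite popWhile≡ t st out = stackRun≡ ts (t ∷ kept t st) (out ++ popped t st)

stackMap≡result : ∀ τ → stackMap-u23-1 τ ≡ result τ
stackMap≡result τ = stackRun≡ τ [] []

Avoids-u23-1 : List ℕ → Set
Avoids-u23-1 xs = contains-u23-1 xs ≡ false

avoids-∷ : ∀ x xs → Avoids-u23-1 (x ∷ xs) → Avoids-u23-1 xs
avoids-∷ x [] _ = refl
avoids-∷ x (y ∷ xs) e with (x <ᵇ y) ∧ any (_<ᵇ x) xs
... | false = e

avoids-++ : ∀ u {xs} → Avoids-u23-1 (u ++ xs) → Avoids-u23-1 xs
avoids-++ [] e = e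
avoids-++ (x ∷ u) {xs} e = avoids-++ u (avoids-∷ x (u ++ xs) e)

kept-avoids : ∀ t st → Avoids-u23-1 (t ∷ kept t st)
kept-avoids t [] = refl
kept-avoids t (s ∷ st) with pops-u23-1 t s st in eq
... | true = kept-avoids t st
... | false = eq

stack-avoids : ∀ q σ → Avoids-u23-1 (stack σ) → Avoids-u23-1 (stack (run q σ))
stack-avoids [] σ avoids = avoids
stack-avoids (t ∷ q) (st , _) _ = stack-avoids q _ (kept-avoids t st)

pops⇒ : ∀ {t} s st → Avoids-u23-1 (s ∷ st) → pops-u23-1 t s st ≡ true → t < s × Any (_< t) st
pops⇒ {t} s st avoids e with Equivalence.to T-∨ (Equivalence.from T-≡ e)
... | inj₂ contains = ⊥-elim (subst T avoids contains)
... | inj₁ both with Equivalence.to T-∧ both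
...   | t<ᵇs , any< = <ᵇ⇒< t s t<ᵇs , Any.map (<ᵇ⇒< _ t) (any⁻ (_<ᵇ t) st any<)

pops⇐ : ∀ {t s st} → t < s → Any (_< t) st → pops-u23-1 t s st ≡ true
pops⇐ {t} {s} {st} t<s any< = Equivalence.to T-≡
  (Equivalence.from T-∨ (inj₁ (Equivalence.from T-∧ (<⇒<ᵇ t<s , any⁺ (_<ᵇ t) (Any.map <⇒<ᵇ any<)))))

pops-false : ∀ {t} s st → Avoids-u23-1 (s ∷ st) → ¬ (t < s × Any (_< t) st) → pops-u23-1 t s st ≡ false
pops-false {t} s st avoids ¬pattern with pops-u23-1 t s st in eq
... | true = ⊥-elim (¬pattern (pops⇒ s st avoids eq))
... | false = refl

popped-above : ∀ {x} t st → Avoids-u23-1 st → x ∈ popped t st → t < x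
popped-above t (s ∷ st) avoids x∈ with pops-u23-1 t s st in eq
popped-above t (s ∷ st) avoids (here refl) | true = proj₁ (pops⇒ s st avoids eq)
popped-above t (s ∷ st) avoids (there x∈) | true = popped-above t st (avoids-∷ s st avoids) x∈

smaller-pops-nothing : ∀ t st → Avoids-u23-1 st → All (t <_) st → kept t st ≡ st
smaller-pops-nothing t [] _ _ = refl
smaller-pops-nothing t (s ∷ st) avoids (_ ∷ larger) with pops-u23-1 t s st in eq
... | false = refl
... | true with All.lookupAny larger (proj₂ (pops⇒ s st avoids eq))
...   | t<z , z<t = ⊥-elim (<-asym t<z z<t)

pop-through : ∀ t u {a v} → All (t <_) u → t < a → Any (_< t) v → a ∈ popped t (u ++ a ∷ v)
pop-through t [] _ t<a any< rewrite pops⇐ t<a any< = here refl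
pop-through t (s ∷ u) {a} {v} (t<s ∷ t<u) t<a any< rewrite pops⇐ t<s (Any-++⁺ʳ u (there {x = a} any<)) =
  there (pop-through t u t<u t<a any<)

no-pop-by-larger : ∀ {t a v} → Avoids-u23-1 (a ∷ v) → a ≤ t → pops-u23-1 t a v ≡ false
no-pop-by-larger {t} {a} {v} avoids a≤t = pops-false {t} a v avoids λ (t<a , _) → <⇒≱ t<a a≤t

no-pop-above-smaller : ∀ {t e v} → Avoids-u23-1 (e ∷ v) → All (e <_) v → pops-u23-1 t e v ≡ false
no-pop-above-smaller {t} {e} {v} avoids e<v = pops-false {t} e v avoids λ (t<e , any<) → smaller-below t<e any<
  where
  smaller-below : t < e → Any (_< t) v → ⊥
  smaller-below t<e any< with All.lookupAny e<v any<
  ... | e<z , z<t = <-asym t<e (<-trans e<z z<t)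

stays-over-larger : ∀ q u out {a v} → Avoids-u23-1 (a ∷ v) → All (a ≤_) q → Stays (u ++ a ∷ v , out) a q
stays-over-larger q u out {a} {v} avoids a≤q =
  stays-unpopped q u out (λ t∈ → no-pop-by-larger {a = a} {v} avoids (All.lookup a≤q t∈)) (here refl)

stays-under-smaller : ∀ q u out {e v x} → Avoids-u23-1 (e ∷ v) → All (e <_) v → x ∈ e ∷ v →
  Stays (u ++ e ∷ v , out) x q
stays-under-smaller q u out {e} {v} avoids e<v = stays-unpopped q u out (λ _ → no-pop-above-smaller {e = e} {v} avoids e<v)

stack-over-larger : ∀ q u out {a v} → Avoids-u23-1 (a ∷ v) → All (a ≤_) q → All (a ≤_) u →
  Σ (List ℕ) λ u′ → stack (run q (u ++ a ∷ v , out)) ≡ u′ ++ a ∷ v × All (a ≤_) u′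
stack-over-larger q u out {a} {v} avoids a≤q =
  stack-unpopped q u out (λ t∈ → no-pop-by-larger {a = a} {v} avoids (All.lookup a≤q t∈)) a≤q

MinimumOnStack : State → Set
MinimumOnStack σ = Σ ℕ λ m → m ∈ stack σ × All (m ≤_) (flush σ)

minimum-step : ∀ t σ → Avoids-u23-1 (stack σ) → flush σ ≡ [] ⊎ MinimumOnStack σ → MinimumOnStack (step t σ)
minimum-step t σ _ (inj₁ empty) =
  t , here refl , All-resp-↭ (↭-sym (flush-step-↭ t σ)) (≤-refl ∷ subst (All (t ≤_)) (sym empty) [])
minimum-step t σ avoids (inj₂ (m , m∈ , m≤)) with t ≤? m
... | yes t≤m = t , here refl , All-resp-↭ (↭-sym (flush-step-↭ t σ)) (≤-refl ∷ All.map (≤-trans t≤m) m≤)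
... | no t≰m with ∈-popped⊎kept t (stack σ) m∈
...   | inj₁ m∈popped = ⊥-elim (<-asym (popped-above t (stack σ) avoids m∈popped) (≰⇒> t≰m))
...   | inj₂ m∈kept = m , there m∈kept , All-resp-↭ (↭-sym (flush-step-↭ t σ)) (<⇒≤ (≰⇒> t≰m) ∷ m≤)

minimum-run : ∀ q σ → Avoids-u23-1 (stack σ) → flush σ ≡ [] ⊎ MinimumOnStack σ →
  flush (run q σ) ≡ [] ⊎ MinimumOnStack (run q σ)
minimum-run [] σ _ minimum = minimum
minimum-run (t ∷ q) σ avoids minimum =
  minimum-run q (step t σ) (kept-avoids t (stack σ)) (inj₂ (minimum-step t σ avoids minimum))

minimum-snoc : ∀ p t → MinimumOnStack (run (p ++ t ∷ []) start)
minimum-snoc p t rewrite run-++ p (t ∷ []) start =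
  minimum-step t (run p start) (stack-avoids p start refl) (minimum-run p start refl (inj₁ refl))

kept-below-pushed : ∀ p {w a} → w ∈ p → w < a → Any (_≤ w) (kept a (stack (run p start)))
kept-below-pushed p {w} {a} w∈p w<a with minimum-run p start refl (inj₁ refl)
... | inj₁ empty = ⊥-elim (¬Any[] (subst (w ∈_) empty (∈-input⇒∈result p w∈p)))
... | inj₂ (m , m∈ , m≤) with ∈-popped⊎kept a (stack (run p start)) m∈
...   | inj₁ m∈popped = ⊥-elim (<⇒≱ (popped-above a (stack (run p start)) (stack-avoids p start refl) m∈popped)
                                     (≤-trans (All.lookup m≤ (∈-input⇒∈result p w∈p)) (<⇒≤ w<a)))
...   | inj₂ m∈kept = Any.map (λ { refl → All.lookup m≤ (∈-input⇒∈result p w∈p) }) m∈kept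

module _ {τ : List ℕ} (u : Unique τ) where

  𝔰-flips-over-larger : ∀ {a b} → Precedes τ a b → (∀ {c} → Precedes τ a c → PrecedesOrEq τ c b → a ≤ c) →
    Precedes (𝔰 τ) b a
  𝔰-flips-over-larger {a} {b} a≺b larger with precedes-split a≺b
  ... | p , q , r , refl rewrite result-pivot p a (q ++ b ∷ r) | run-snoc q b r (step a (run p start)) =
    precedes-run r _ (stays-precedes (q ++ b ∷ []) stays (∈-++⁺ʳ q (here refl)) (precedes-≢ u a≺b))
    where
    a≤q : All (a ≤_) (q ++ b ∷ [])
    a≤q = All.++⁺ (between-All p λ a≺c c≺b → larger a≺c [ c≺b ]) (larger a≺b refl ∷ [])
    stays : Stays (step a (run p start)) a (q ++ b ∷ [])
    stays = stays-over-larger _ [] _ (kept-avoids a (stack (run p start))) a≤q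

  -- e is smaller than every entry on the stack, so it pops nothing, and neither e nor anything below it
  -- is ever popped afterwards.
  𝔰-flips-before-minimum : ∀ {a e b} → NextSmaller τ a e → LeftToRightMinimum τ e → Precedes τ a b →
    Precedes (𝔰 τ) b a
  𝔰-flips-before-minimum {a} {e} {b} (a≺e , _ , larger) minimum a≺b with precedes-split a≺e
  ... | p , q , r , refl rewrite result-pivot p a (q ++ e ∷ r) =
    stays-precedes (q ++ e ∷ r) (stays-++ q (e ∷ r) stays-q (a∈σ₁ , stays-r))
      (pivot-precedes⁻ p u a≺b) (precedes-≢ u a≺b)
    where
    σa = step a (run p start)
    σ₁ = run q σa
    stays-q : Stays σa a q
    stays-q = stays-over-larger q [] _ (kept-avoids a (stack (run p start))) (between-All p larger)
    a∈σ₁ : a ∈ stack σ₁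
    a∈σ₁ = stays-last q stays-q
    e<σ₁ : All (e <_) (stack σ₁)
    e<σ₁ = All.tabulate λ x∈ → minimum (before-second⁺ p (∈-stack⇒∈input (p ++ a ∷ q)
      (subst (λ σ → _ ∈ stack σ) (sym (run-++ p (a ∷ q) start)) x∈)))
    unchanged : kept e (stack σ₁) ≡ stack σ₁
    unchanged = smaller-pops-nothing e (stack σ₁) (stack-avoids q σa (kept-avoids a (stack (run p start)))) e<σ₁
    stays-r : Stays (step e σ₁) a r
    stays-r = subst (λ st → Stays (e ∷ st , output (step e σ₁)) a r) (sym unchanged)
      (stays-under-smaller r [] _ (subst (λ st → Avoids-u23-1 (e ∷ st)) unchanged (kept-avoids e (stack σ₁)))
        e<σ₁ (there a∈σ₁))

  -- When e arrives, some entry ≤ w < e lies below a on the stack, so e pops a and everything above it.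
  𝔰-popped-by-next-smaller : ∀ {a e w b} → NextSmaller τ a e → Precedes τ w e → w < e → PrecedesOrEq τ e b →
    Precedes (𝔰 τ) a b
  𝔰-popped-by-next-smaller {a} {e} {w} {b} (a≺e , e<a , larger) w≺e w<e e≼b with precedes-split a≺e
  ... | p , q , r , refl rewrite result-pivot p a (q ++ e ∷ r) | run-++ q (e ∷ r) (step a (run p start)) =
    popped-precedes-run e (run q σa) r a∈popped b∈
    where
    σp = run p start
    σa = step a σp
    a≤q : All (a ≤_) q
    a≤q = between-All p larger
    w∈p : w ∈ p
    w∈p with ∈-++⁻ p (before-second⁻ p u w≺e)
    ... | inj₁ w∈p = w∈p
    ... | inj₂ (here refl) = ⊥-elim (<-asym w<e e<a)
    ... | inj₂ (there w∈q) = ⊥-elim (<⇒≱ (<-trans w<e e<a) (All.lookup a≤q w∈q))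
    small-kept : Any (_< e) (kept a (stack σp))
    small-kept = Any.map (λ m≤w → ≤-<-trans m≤w w<e) (kept-below-pushed p w∈p (<-trans w<e e<a))
    a∈popped : a ∈ popped e (stack (run q σa))
    a∈popped with stack-over-larger q [] (output σa) (kept-avoids a (stack σp)) a≤q []
    ... | u′ , stack≡ , a≤u′ =
      subst (λ st → a ∈ popped e st) (sym stack≡) (pop-through e u′ (All.map (<-≤-trans e<a) a≤u′) e<a small-kept)
    b∈ : b ∈ e ∷ r
    b∈ = after-second-or-eq⁻ p u e≼b

  -- Take m minimal on the stack after w is pushed: the entries below m are larger, so m is never popped.
  𝔰-stack-minimum : ∀ {w} → w ∈ τ → Σ ℕ λ m → m ≤ w × (∀ {b} → Precedes τ w b → Precedes (𝔰 τ) b m)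
  𝔰-stack-minimum {w} w∈ with ∈-∃++ w∈
  ... | p , r , refl with minimum-snoc p w
  ...   | m , m∈ , m≤ = m , All.lookup m≤ (∈-input⇒∈result (p ++ w ∷ []) (∈-++⁺ʳ p (here refl))) , m-last
    where
    σw = run (p ++ w ∷ []) start
    u′ : Unique ((p ++ w ∷ []) ++ r)
    u′ = subst Unique (sym (++-assoc p (w ∷ []) r)) u
    flush-unique : Unique (flush σw)
    flush-unique = result-unique (unique-++ˡ (p ++ w ∷ []) u′)
    stays : Stays σw m r
    stays with ∈-∃++ m∈
    ... | us , vs , stack≡ = subst (λ st → Stays (st , output σw) m r) (sym stack≡)
      (stays-under-smaller r us (output σw) avoids (All.tabulate m<) (here refl))
      where
      avoids : Avoids-u23-1 (m ∷ vs)
      avoids = avoids-++ us (subst Avoids-u23-1 stack≡ (stack-avoids (p ++ w ∷ []) start refl))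
      m∉vs : m ∉ vs
      m∉vs = Unique[x∷xs]⇒x∉xs (unique-++ʳ us (subst Unique stack≡ (unique-++ʳ (output σw) flush-unique)))
      m< : ∀ {x} → x ∈ vs → m < x
      m< x∈ = ≤∧≢⇒< (All.lookup m≤ (∈-++⁺ʳ (output σw) (subst (_ ∈_) (sym stack≡) (∈-++⁺ʳ us (there x∈)))))
                    (λ { refl → m∉vs x∈ })
    m-last : ∀ {b} → Precedes (p ++ w ∷ r) w b → Precedes (𝔰 (p ++ w ∷ r)) b m
    m-last w≺b rewrite run-snoc p w r start =
      stays-precedes r stays b∈r (λ { refl → unique-++-disjoint u′ (∈-stack⇒∈input (p ++ w ∷ []) m∈) b∈r })
      where b∈r = pivot-precedes⁻ p u w≺b

-- The configurations that 𝔰 turns into a 231: a 1324 read w x e y, and a μ₂₄₁₃ read z y e x.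

Canonical1324 : List ℕ → Set
Canonical1324 τ = Σ ℕ λ x → Σ ℕ λ y → Σ ℕ λ e → Σ ℕ λ w →
  NextSmaller τ x e × Precedes τ w e × w < e × Precedes τ e y × x < y

Canonical2413 : List ℕ → Set
Canonical2413 τ = Σ ℕ λ z → Σ ℕ λ y → Σ ℕ λ x → Σ ℕ λ e →
  Precedes τ z y × Precedes τ y x × z < x × x < y × NextSmaller τ y e × LeftToRightMinimum τ e

Canonical : List ℕ → Set
Canonical τ = Canonical1324 τ ⊎ Canonical2413 τ

TightMesh2413 : List ℕ → Set
TightMesh2413 τ = Σ ℕ λ p → Σ ℕ λ q → Σ ℕ λ f → Σ ℕ λ s →
  Precedes τ p q × Adjacent τ q f × Precedes τ f s × f < p × p < s × s < q ×
  (∀ {c} → Precedes τ p c → Precedes τ c q → f ≤ c)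

module _ {τ : List ℕ} (u : Unique τ) where

  private
    𝔰-unique : Unique (𝔰 τ)
    𝔰-unique = result-unique u

  𝔰-kept-order : ∀ {a b} → Precedes τ a b → Precedes (𝔰 τ) a b →
    Σ ℕ λ e → Σ ℕ λ w → NextSmaller τ a e × PrecedesOrEq τ e b × Precedes τ w e × w < e
  𝔰-kept-order a≺b a≺′b with first-below-until u _ a≺b
  ... | inj₂ larger = ⊥-elim (precedes-asym 𝔰-unique a≺′b (𝔰-flips-over-larger u a≺b larger))
  ... | inj₁ (e , next , e≼b) with left-to-right-minimum? u (precedes-∈ʳ (proj₁ next))
  ...   | inj₁ (w , w≺e , w<e) = e , w , next , e≼b , w≺e , w<e
  ...   | inj₂ minimum = ⊥-elim (precedes-asym 𝔰-unique a≺′b (𝔰-flips-before-minimum u next minimum a≺b))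

  𝔰-flipped-descent : ∀ {a b} → Precedes τ a b → b < a → Precedes (𝔰 τ) b a →
    Σ ℕ λ e → NextSmaller τ a e × LeftToRightMinimum τ e
  𝔰-flipped-descent a≺b b<a b≺′a with next-smaller u a≺b b<a
  ... | e , next , e≼b with left-to-right-minimum? u (precedes-∈ʳ (proj₁ next))
  ...   | inj₁ (w , w≺e , w<e) = ⊥-elim (precedes-asym 𝔰-unique b≺′a (𝔰-popped-by-next-smaller u next w≺e w<e e≼b))
  ...   | inj₂ minimum = e , next , minimum

  𝔰-231⇒canonical : Has231 (𝔰 τ) → Canonical τ
  𝔰-231⇒canonical (x , y , z , x≺′y , y≺′z , z<x , x<y)
    with order-in-input x≺′y (<⇒≢ x<y)
  ... | inj₁ x≺y with 𝔰-kept-order x≺y x≺′y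
  ...   | e , w , next@(_ , e<x , _) , e≼y , w≺e , w<e =
    inj₁ (x , y , e , w , next , w≺e , w<e , precedesOrEq∧≢⇒precedes e≼y (<⇒≢ (<-trans e<x x<y)) , x<y)
  𝔰-231⇒canonical (x , y , z , x≺′y , y≺′z , z<x , x<y) | inj₂ y≺x with 𝔰-flipped-descent y≺x x<y x≺′y
  ... | e , next , minimum
    with order-in-input y≺′z (>⇒≢ (<-trans z<x x<y))
  ...   | inj₂ z≺y = inj₂ (z , y , x , e , z≺y , y≺x , z<x , x<y , next , minimum)
  ...   | inj₁ y≺z with 𝔰-kept-order y≺z y≺′z
  ...     | e′ , w , next′ , _ , w≺e′ , w<e′ with first-below-unique u next next′
  ...       | refl = ⊥-elim (<-asym w<e′ (minimum w≺e′))

  canonical1324⇒𝔰-231 : Canonical1324 τ → Has231 (𝔰 τ)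
  canonical1324⇒𝔰-231 (x , y , e , w , next@(_ , e<x , _) , w≺e , w<e , e≺y , x<y)
    with 𝔰-stack-minimum u (precedes-∈ˡ w≺e)
  ... | m , m≤w , after-w-first =
    x , y , m , 𝔰-popped-by-next-smaller u next w≺e w<e [ e≺y ] , after-w-first (precedes-trans u w≺e e≺y) ,
    ≤-<-trans m≤w (<-trans w<e e<x) , x<y

  canonical2413⇒𝔰-231 : Canonical2413 τ → Has231 (𝔰 τ)
  canonical2413⇒𝔰-231 (z , y , x , e , z≺y , y≺x , z<x , x<y , next , minimum)
    with 𝔰-stack-minimum u (precedes-∈ˡ z≺y)
  ... | m , m≤z , after-z-first =
    x , y , m , 𝔰-flips-before-minimum u next minimum y≺x , after-z-first z≺y , ≤-<-trans m≤z z<x , x<y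

  canonical1324⇒1324 : Canonical1324 τ → Has1324 τ
  canonical1324⇒1324 (x , y , e , w , (x≺e , e<x , x≤between) , w≺e , w<e , e≺y , x<y) =
    w , x , e , y , w≺x , x≺e , e≺y , w<e , e<x , x<y
    where
    w≺x = precedes-ordered (precedes-∈ˡ w≺e) (precedes-∈ˡ x≺e) (<⇒≢ (<-trans w<e e<x))
            (λ x≺w → <⇒≱ (<-trans w<e e<x) (x≤between x≺w w≺e))

  canonical2413⇒mesh2413 : Canonical2413 τ → HasMesh2413 τ
  canonical2413⇒mesh2413 (z , y , x , e , z≺y , y≺x , z<x , x<y , (y≺e , e<y , y≤between) , minimum) =
    z , y , e , x , z≺y , y≺e , e≺x , e<z , z<x , x<y ,
    (λ _ c≺y → <⇒≤ (minimum (precedes-trans u c≺y y≺e))) ,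
    (λ y≺c c≺e _ → <⇒≤ (<-≤-trans x<y (y≤between y≺c c≺e)))
    where
    e<z = minimum (precedes-trans u z≺y y≺e)
    e≺x = precedes-ordered (precedes-∈ʳ y≺e) (precedes-∈ʳ y≺x) (<⇒≢ (<-trans e<z z<x))
            (λ x≺e → <⇒≱ x<y (y≤between y≺x x≺e))

  1324⇒canonical : Has1324 τ → Canonical τ
  1324⇒canonical (a , c , b , d , a≺c , c≺b , b≺d , a<b , b<c , c<d) with next-smaller u c≺b b<c
  ... | e , next , e≼b with left-to-right-minimum? u (precedes-∈ʳ (proj₁ next))
  ...   | inj₁ (w , w≺e , w<e) = inj₁ (c , d , e , w , next , w≺e , w<e , precedesOrEq-precedes u e≼b b≺d , c<d)
  ...   | inj₂ minimum = inj₂ (a , c , b , e , a≺c , c≺b , a<b , b<c , next , minimum)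

  mesh2413⇒tight : HasMesh2413 τ → TightMesh2413 τ
  mesh2413⇒tight (p , q , r , s , p≺q , q≺r , r≺s , r<p , p<s , s<q , box₁ , box₂)
    with first-below u s q≺r (<-trans r<p p<s)
  ... | f , (q≺f , f<s , s≤between) , f≼r with predecessor u q≺f
  ...   | q′ , adjacent@(q′≺f , _) , q≼q′ =
    p , q′ , f , s , precedes-precedesOrEq u p≺q q≼q′ , adjacent , f≺s ,
    ≤-<-trans (at-most-r q≺f f<s f≼r) r<p , p<s , above-s q≼q′ q′≺f , tight-box
    where
    f≺s = precedesOrEq-precedes u f≼r r≺s
    at-most-r : ∀ {x} → Precedes τ q x → x < s → PrecedesOrEq τ x r → x ≤ r
    at-most-r _ _ refl = ≤-refl
    at-most-r q≺x x<s [ x≺r ] = ≮⇒≥ λ r<x → <⇒≱ x<s (box₂ q≺x x≺r r<x)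
    above-s : ∀ {x} → PrecedesOrEq τ q x → Precedes τ x f → s < x
    above-s refl _ = s<q
    above-s [ q≺x ] x≺f = ≤∧≢⇒< (s≤between q≺x x≺f) λ { refl → precedes-irrefl u (precedes-trans u x≺f f≺s) }
    tight-box : ∀ {c} → Precedes τ p c → Precedes τ c q′ → f ≤ c
    tight-box {c} p≺c c≺q′ with c ≟ q
    ... | yes refl = <⇒≤ (<-trans f<s s<q)
    ... | no c≢q with precedes-total (precedes-∈ʳ p≺c) (precedes-∈ʳ p≺q) c≢q
    ...   | inj₁ c≺q = ≤-trans (at-most-r q≺f f<s f≼r) (box₁ p≺c c≺q)
    ...   | inj₂ q≺c = <⇒≤ (<-≤-trans f<s (s≤between q≺c (precedes-trans u c≺q′ q′≺f)))

  tight⇒canonical : TightMesh2413 τ → Canonical τ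
  tight⇒canonical (p , q , f , s , p≺q , (q≺f , adjacent) , f≺s , f<p , p<s , s<q , box)
    with left-to-right-minimum? u (precedes-∈ʳ q≺f)
  ... | inj₂ f-minimum =
    inj₂ (p , q , s , f , p≺q , precedes-trans u q≺f f≺s , p<s , s<q ,
          (q≺f , <-trans (<-trans f<p p<s) s<q , λ q≺c c≺f → ⊥-elim (adjacent q≺c c≺f)) , f-minimum)
  ... | inj₁ (w , w≺f , w<f) with next-smaller u (precedes-trans u p≺q q≺f) f<p
  ...   | g , next-g@(p≺g , _ , _) , g≼f with left-to-right-minimum? u (precedes-∈ʳ p≺g)
  ...     | inj₁ (w′ , w′≺g , w′<g) =
    inj₁ (p , s , g , w′ , next-g , w′≺g , w′<g , precedesOrEq-precedes u g≼f f≺s , p<s)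
  ...     | inj₂ g-minimum = ⊥-elim (<⇒≱ (<-trans g<w w<f) (box p≺g g≺q))
    where
    f<q = <-trans (<-trans f<p p<s) s<q
    w≺q = precedes-ordered (precedes-∈ˡ w≺f) (precedes-∈ˡ q≺f) (<⇒≢ (<-trans w<f f<q)) λ q≺w → adjacent q≺w w≺f
    w≺p = precedes-ordered (precedes-∈ˡ w≺f) (precedes-∈ˡ p≺q) (<⇒≢ (<-trans w<f f<p)) λ p≺w → <⇒≱ w<f (box p≺w w≺q)
    g<w = g-minimum (precedes-trans u w≺p p≺g)
    g≺f = precedesOrEq∧≢⇒precedes g≼f (<⇒≢ (<-trans g<w w<f))
    g≺q = precedes-ordered (precedes-∈ˡ g≺f) (precedes-∈ˡ q≺f) (<⇒≢ (<-trans (<-trans g<w w<f) f<q))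
            λ q≺g → adjacent q≺g g≺f

module _ {τ : List ℕ} (u : Unique τ) where

  𝔰-231⇔canonical : Has231 (𝔰 τ) ⇔ Canonical τ
  𝔰-231⇔canonical = mk⇔ (𝔰-231⇒canonical u) [ canonical1324⇒𝔰-231 u , canonical2413⇒𝔰-231 u ]′

  patterns⇔canonical : (Has1324 τ ⊎ HasMesh2413 τ) ⇔ Canonical τ
  patterns⇔canonical = mk⇔ [ 1324⇒canonical u , tight⇒canonical u ∘ mesh2413⇒tight u ]′
                           (Sum.map (canonical1324⇒1324 u) (canonical2413⇒mesh2413 u))

-- Occurrences given by index functions

module _ {A : Set} where

  lookup-precedes : ∀ (xs : List A) {i j : Fin (length xs)} → toℕ i < toℕ j →
    Precedes xs (lookup xs i) (lookup xs j)
  lookup-precedes (x ∷ xs) {zero} {suc j} _ = head (∈-lookup j)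
  lookup-precedes (x ∷ xs) {suc i} {suc j} i<j = tail (lookup-precedes xs (s<s⁻¹ i<j))

  precedes-lookup : ∀ {xs : List A} {i j : Fin (length xs)} → Unique xs →
    Precedes xs (lookup xs i) (lookup xs j) → toℕ i < toℕ j
  precedes-lookup {xs} {i} {j} u i≺j with <-cmp (toℕ i) (toℕ j)
  ... | tri< i<j _ _ = i<j
  ... | tri≈ _ i≡j _ rewrite toℕ-injective i≡j = ⊥-elim (precedes-irrefl u i≺j)
  ... | tri> _ _ j<i = ⊥-elim (precedes-asym u i≺j (lookup-precedes xs j<i))

  index-of : ∀ {xs : List A} {x} → x ∈ xs → Σ (Fin (length xs)) λ i → lookup xs i ≡ x
  index-of x∈ = Any.index x∈ , sym (lookup-index x∈)

  AllPairs-lookup : ∀ {R : A → A → Set} {xs} → AllPairs R xs → ∀ {i j} → toℕ i < toℕ j → R (lookup xs i) (lookup xs j)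
  AllPairs-lookup pairs i<j = AllPairs⇒precedes pairs (lookup-precedes _ i<j)

  lookup-injective : ∀ {xs : List A} → Unique xs → ∀ {i j} → lookup xs i ≡ lookup xs j → i ≡ j
  lookup-injective {x ∷ xs} _ {zero} {zero} _ = refl
  lookup-injective {x ∷ xs} (x∉ ∷ _) {zero} {suc j} x≡ = ⊥-elim (All.lookup x∉ (∈-lookup j) x≡)
  lookup-injective {x ∷ xs} (x∉ ∷ _) {suc i} {zero} ≡x = ⊥-elim (All.lookup x∉ (∈-lookup i) (sym ≡x))
  lookup-injective {x ∷ xs} (_ ∷ u) {suc i} {suc j} eq = cong suc (lookup-injective u eq)

increasing-lookup⁻ : ∀ {xs : List ℕ} → AllPairs _<_ xs → ∀ {i j} → lookup xs i < lookup xs j → toℕ i < toℕ j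
increasing-lookup⁻ {xs} increasing {i} {j} xi<xj with <-cmp (toℕ i) (toℕ j)
... | tri< i<j _ _ = i<j
... | tri≈ _ i≡j _ = ⊥-elim (<-irrefl (cong (lookup xs) (toℕ-injective i≡j)) xi<xj)
... | tri> _ _ j<i = ⊥-elim (<-asym xi<xj (AllPairs-lookup increasing j<i))

lookup-increasing : ∀ {n} {is : List (Fin n)} → Linked (_<_ on toℕ) is →
  ∀ a b → toℕ a < toℕ b → toℕ (lookup is a) < toℕ (lookup is b)
lookup-increasing linked _ _ = AllPairs-lookup {R = _<_ on toℕ} (Linked⇒AllPairs <-trans linked)

-- ws lists the values of the occurrence in increasing order, and rank a is the 0-based rank of entry a.
occurrence-by-rank : ∀ {π ρ : List ℕ} (idx : Fin (length ρ) → Fin (length π))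
  (ws : List ℕ) (rank : Fin (length ρ) → Fin (length ws)) →
  (∀ a b → toℕ a < toℕ b → toℕ (idx a) < toℕ (idx b)) → AllPairs _<_ ws →
  (∀ a → lookup ρ a ≡ suc (toℕ (rank a))) → (∀ a → lookup π (idx a) ≡ lookup ws (rank a)) → Occurrence π ρ
occurrence-by-rank {π} {ρ} idx ws rank increasing-idx increasing-ws ρ≡rank π≡ws = record
  { idx = idx ; mono = increasing-idx ; iso = λ a b → mk⇔ (to a b) (from a b) }
  where
  to : ∀ a b → lookup ρ a < lookup ρ b → lookup π (idx a) < lookup π (idx b)
  to a b ρa<ρb = subst₂ _<_ (sym (π≡ws a)) (sym (π≡ws b))
    (AllPairs-lookup increasing-ws (s<s⁻¹ (subst₂ _<_ (ρ≡rank a) (ρ≡rank b) ρa<ρb)))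
  from : ∀ a b → lookup π (idx a) < lookup π (idx b) → lookup ρ a < lookup ρ b
  from a b πa<πb = subst₂ _<_ (sym (ρ≡rank a)) (sym (ρ≡rank b))
    (s<s (increasing-lookup⁻ increasing-ws (subst₂ _<_ (π≡ws a) (π≡ws b) πa<πb)))

fin4-cases : ∀ {P : Fin 4 → Set} → P (# 0) → P (# 1) → P (# 2) → P (# 3) → ∀ a → P a
fin4-cases p₀ _ _ _ zero = p₀
fin4-cases _ p₁ _ _ (suc zero) = p₁
fin4-cases _ _ p₂ _ (suc (suc zero)) = p₂
fin4-cases _ _ _ p₃ (suc (suc (suc zero))) = p₃

module _ {π ρ : List ℕ} (o : Occurrence π ρ) where

  entry : Fin (length ρ) → ℕ
  entry a = lookup π (idx o a)

  entry-precedes : ∀ a b {a<b : True (toℕ a <? toℕ b)} → Precedes π (entry a) (entry b)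
  entry-precedes a b {a<b} = lookup-precedes π (mono o a b (toWitness a<b))

  entry-< : ∀ a b {ρa<ρb : True (lookup ρ a <? lookup ρ b)} → entry a < entry b
  entry-< a b {ρa<ρb} = Equivalence.to (iso o a b) (toWitness ρa<ρb)

  pos-above⁺ : ∀ c {j : Fin (length π)} → toℕ (idx o c) < toℕ j → PosAbove o (suc (toℕ c)) (suc (toℕ j))
  pos-above⁺ c lt = inj₂ (c , refl , s<s lt)

  pos-above⁻ : ∀ c {j : Fin (length π)} → PosAbove o (suc (toℕ c)) (suc (toℕ j)) → Precedes π (entry c) (lookup π j)
  pos-above⁻ c (inj₂ (_ , eq , lt)) with toℕ-injective (suc-injective eq)
  ... | refl = lookup-precedes π (s<s⁻¹ lt)

  pos-below⁺ : ∀ c {j : Fin (length π)} → toℕ j < toℕ (idx o c) → PosBelow o (suc (toℕ c)) (suc (toℕ j))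
  pos-below⁺ c lt = inj₂ (c , refl , s<s lt)

  pos-below⁻ : ∀ c {j : Fin (length π)} → PosBelow o (suc (toℕ c)) (suc (toℕ j)) → Precedes π (lookup π j) (entry c)
  pos-below⁻ c (inj₁ eq) = ⊥-elim (<-irrefl (suc-injective eq) (toℕ<n c))
  pos-below⁻ c (inj₂ (_ , eq , lt)) with toℕ-injective (suc-injective eq)
  ... | refl = lookup-precedes π (s<s⁻¹ lt)

  val-above⁺ : ∀ c {x} → entry c < x → ValAbove o (lookup ρ c) x
  val-above⁺ c lt = inj₂ (c , refl , lt)

  val-above⁻ : ∀ c {x} → Unique ρ → lookup ρ c ≢ 0 → ValAbove o (lookup ρ c) x → entry c < x
  val-above⁻ c _ nonzero (inj₁ eq) = ⊥-elim (nonzero eq)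
  val-above⁻ c u _ (inj₂ (_ , eq , lt)) with lookup-injective u eq
  ... | refl = lt

  val-below⁺ : ∀ c {x} → x < entry c → ValBelow o (lookup ρ c) x
  val-below⁺ c lt = inj₂ (c , refl , lt)

  val-below⁻ : ∀ c {x} → Unique ρ → lookup ρ c ≢ suc (length ρ) → ValBelow o (lookup ρ c) x → x < entry c
  val-below⁻ c _ not-top (inj₁ eq) = ⊥-elim (not-top eq)
  val-below⁻ c u _ (inj₂ (_ , eq , lt)) with lookup-injective u eq
  ... | refl = lt

contains1324⇔has1324 : ∀ {τ} → Unique τ → Contains τ (1 ∷ 3 ∷ 2 ∷ 4 ∷ []) ⇔ Has1324 τ
contains1324⇔has1324 {τ} u = mk⇔ to from
  where
  to : Contains τ (1 ∷ 3 ∷ 2 ∷ 4 ∷ []) → Has1324 τ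
  to o = entry o (# 0) , entry o (# 1) , entry o (# 2) , entry o (# 3) ,
    entry-precedes o (# 0) (# 1) , entry-precedes o (# 1) (# 2) , entry-precedes o (# 2) (# 3) ,
    entry-< o (# 0) (# 2) , entry-< o (# 2) (# 1) , entry-< o (# 1) (# 3)
  from : Has1324 τ → Contains τ (1 ∷ 3 ∷ 2 ∷ 4 ∷ [])
  from (_ , _ , _ , _ , a≺c , c≺b , b≺d , a<b , b<c , c<d)
    with index-of (precedes-∈ˡ a≺c) | index-of (precedes-∈ˡ c≺b) | index-of (precedes-∈ˡ b≺d) | index-of (precedes-∈ʳ b≺d)
  ... | i , refl | j , refl | k , refl | l , refl =
    occurrence-by-rank (lookup (i ∷ j ∷ k ∷ l ∷ [])) (lookup τ i ∷ lookup τ k ∷ lookup τ j ∷ lookup τ l ∷ [])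
      (lookup (# 0 ∷ # 2 ∷ # 1 ∷ # 3 ∷ []))
      (lookup-increasing (precedes-lookup u a≺c ∷ precedes-lookup u c≺b ∷ precedes-lookup u b≺d ∷ [-]))
      (Linked⇒AllPairs <-trans (a<b ∷ b<c ∷ c<d ∷ [-]))
      (fin4-cases refl refl refl refl) (fin4-cases refl refl refl refl)

2413-unique : Unique (2 ∷ 4 ∷ 1 ∷ 3 ∷ [])
2413-unique = toWitness {a? = unique? (2 ∷ 4 ∷ 1 ∷ 3 ∷ [])} _

meshContains2413⇔hasMesh2413 : ∀ {τ} → Unique τ →
  MeshContains τ (2 ∷ 4 ∷ 1 ∷ 3 ∷ []) mu2413-shading ⇔ HasMesh2413 τ
meshContains2413⇔hasMesh2413 {τ} u = mk⇔ to from
  where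
  to : MeshContains τ (2 ∷ 4 ∷ 1 ∷ 3 ∷ []) mu2413-shading → HasMesh2413 τ
  to (o , empty) = p , q , r , s ,
    entry-precedes o (# 0) (# 1) , entry-precedes o (# 1) (# 2) , entry-precedes o (# 2) (# 3) ,
    entry-< o (# 2) (# 0) , entry-< o (# 0) (# 3) , entry-< o (# 3) (# 1) , box₁ , box₂
    where
    p = entry o (# 0)
    q = entry o (# 1)
    r = entry o (# 2)
    s = entry o (# 3)
    box₁ : ∀ {c} → Precedes τ p c → Precedes τ c q → r ≤ c
    box₁ p≺c c≺q with index-of (precedes-∈ʳ p≺c)
    ... | j , refl = ≮⇒≥ λ c<r → empty (here refl) j
      (pos-above⁺ o (# 0) (precedes-lookup u p≺c) , pos-below⁺ o (# 1) (precedes-lookup u c≺q) , inj₁ refl ,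
       val-below⁺ o (# 2) c<r)
    box₂ : ∀ {c} → Precedes τ q c → Precedes τ c r → r < c → s ≤ c
    box₂ {c} q≺c c≺r r<c with index-of (precedes-∈ʳ q≺c)
    ... | j , refl = ≮⇒≥ λ c<s → in-box (<-cmp c p) c<s
      where
      after-q = pos-above⁺ o (# 1) (precedes-lookup u q≺c)
      before-r = pos-below⁺ o (# 2) (precedes-lookup u c≺r)
      in-box : Tri (c < p) (c ≡ p) (p < c) → c < s → ⊥
      in-box (tri< c<p _ _) _ =
        empty (there (here refl)) j (after-q , before-r , val-above⁺ o (# 2) r<c , val-below⁺ o (# 0) c<p)
      in-box (tri≈ _ c≡p _) _ = precedes-asym u (entry-precedes o (# 0) (# 1)) (subst (Precedes τ q) c≡p q≺c)
      in-box (tri> _ _ p<c) c<s =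
        empty (there (there (here refl))) j (after-q , before-r , val-above⁺ o (# 0) p<c , val-below⁺ o (# 3) c<s)
  from : HasMesh2413 τ → MeshContains τ (2 ∷ 4 ∷ 1 ∷ 3 ∷ []) mu2413-shading
  from (_ , _ , _ , _ , p≺q , q≺r , r≺s , r<p , p<s , s<q , box₁ , box₂)
    with index-of (precedes-∈ˡ p≺q) | index-of (precedes-∈ˡ q≺r) | index-of (precedes-∈ˡ r≺s) | index-of (precedes-∈ʳ r≺s)
  ... | i , refl | j , refl | k , refl | l , refl = o , empty
    where
    o : Occurrence τ (2 ∷ 4 ∷ 1 ∷ 3 ∷ [])
    o = occurrence-by-rank (lookup (i ∷ j ∷ k ∷ l ∷ [])) (lookup τ k ∷ lookup τ i ∷ lookup τ l ∷ lookup τ j ∷ [])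
      (lookup (# 1 ∷ # 3 ∷ # 0 ∷ # 2 ∷ []))
      (lookup-increasing (precedes-lookup u p≺q ∷ precedes-lookup u q≺r ∷ precedes-lookup u r≺s ∷ [-]))
      (Linked⇒AllPairs <-trans (r<p ∷ p<s ∷ s<q ∷ [-]))
      (fin4-cases refl refl refl refl) (fin4-cases refl refl refl refl)
    empty : ∀ {ab} → ab ∈ mu2413-shading → BoxEmpty o ab
    empty (here refl) c (above , below , _ , c<r) =
      <⇒≱ (val-below⁻ o (# 2) 2413-unique (λ ()) c<r) (box₁ (pos-above⁻ o (# 0) above) (pos-below⁻ o (# 1) below))
    empty (there (here refl)) c (above , below , r<c , c<p) =
      <⇒≱ (<-trans (val-below⁻ o (# 0) 2413-unique (λ ()) c<p) p<s)
          (box₂ (pos-above⁻ o (# 1) above) (pos-below⁻ o (# 2) below) (val-above⁻ o (# 2) 2413-unique (λ ()) r<c))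
    empty (there (there (here refl))) c (above , below , p<c , c<s) =
      <⇒≱ (val-below⁻ o (# 3) 2413-unique (λ ()) c<s)
          (box₂ (pos-above⁻ o (# 1) above) (pos-below⁻ o (# 2) below)
                (<-trans r<p (val-above⁻ o (# 0) 2413-unique (λ ()) p<c)))

-- Sorting with s ∘ 𝔰

idPerm-increasing : ∀ n → AllPairs _<_ (idPerm n)
idPerm-increasing n = AllPairs.map⁺ (AllPairs.map s≤s (AllPairs.applyUpTo⁺₁ (λ i → i) n (λ i<j _ → i<j)))

increasing-↭-unique : ∀ {xs ys} → AllPairs _<_ xs → AllPairs _<_ ys → xs ↭ ys → xs ≡ ys
increasing-↭-unique xs< ys< xs↭ys = Pointwise-≡⇒≡ (↗↭↗⇒≋ ≤-totalOrder (sorted xs<) (sorted ys<) (↭⇒↭ₛ xs↭ys))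
  where
  sorted : ∀ {zs} → AllPairs _<_ zs → Sorted ≤-totalOrder zs
  sorted = AllPairs⇒Sorted ≤-totalOrder ∘ AllPairs.map <⇒≤

≡idPerm⇔increasing : ∀ {n xs} → xs ↭ idPerm n → (xs ≡ idPerm n) ⇔ AllPairs _<_ xs
≡idPerm⇔increasing {n} xs↭id = mk⇔ (λ xs≡id → subst (AllPairs _<_) (sym xs≡id) (idPerm-increasing n))
  (λ xs< → increasing-↭-unique xs< (idPerm-increasing n) xs↭id)

permutation-unique : ∀ {n τ} → τ ↭ idPerm n → Unique τ
permutation-unique {n} τ↭id = unique-resp-↭ (↭-sym τ↭id) (AllPairs.map <⇒≢ (idPerm-increasing n))

sortedBy⇔𝔰-avoids231 : ∀ {n τ} → τ ↭ idPerm n → SortedBy-u23-1 n τ ⇔ (¬ Has231 (𝔰 τ))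
sortedBy⇔𝔰-avoids231 {n} {τ} τ↭id rewrite stackMap≡result τ | West.westSort≡result (𝔰 τ) =
  ⇔-trans (≡idPerm⇔increasing (↭-trans (West.result-↭ (𝔰 τ)) (↭-trans (result-↭ τ) τ↭id)))
          (West.west-sorted⇔avoids231 (result-unique (permutation-unique τ↭id)))

𝔰-231⇔contains : ∀ {τ} → Unique τ →
  Has231 (𝔰 τ) ⇔ (Contains τ (1 ∷ 3 ∷ 2 ∷ 4 ∷ []) ⊎ MeshContains τ (2 ∷ 4 ∷ 1 ∷ 3 ∷ []) mu2413-shading)
𝔰-231⇔contains u = ⇔-trans (𝔰-231⇔canonical u)
  (⇔-sym (⇔-trans (contains1324⇔has1324 u ⊎-⇔ meshContains2413⇔hasMesh2413 u) (patterns⇔canonical u)))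

¬-⊎⇔ : ∀ {A B : Set} → (¬ (A ⊎ B)) ⇔ (¬ A × ¬ B)
¬-⊎⇔ = mk⇔ (λ ¬A⊎B → ¬A⊎B ∘ inj₁ , ¬A⊎B ∘ inj₂) (uncurry _¬-⊎_)

mainTheorem4 : (n : ℕ) → 1 ≤ n → (τ : List ℕ) → τ ↭ idPerm n →
    SortedBy-u23-1 n τ ⇔
      (Avoids τ (1 ∷ 3 ∷ 2 ∷ 4 ∷ []) × AvoidsMesh τ (2 ∷ 4 ∷ 1 ∷ 3 ∷ []) mu2413-shading)
mainTheorem4 n _ τ τ↭id =
  ⇔-trans (sortedBy⇔𝔰-avoids231 τ↭id) (⇔-trans (¬-cong-⇔ (𝔰-231⇔contains (permutation-unique τ↭id))) ¬-⊎⇔)
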